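{- Let $a$ and $x$ be positive integers with $x<a-1$, let $S=\langle a,a+1,\ldots,a+x\rangle$, and let $n=\left\lceil\frac{a-1}{x}\right\rceil$. Then \[ r(S)=\begin{cases}\frac{n^2-1}{8}x+\frac{n-1}{2} & \text{if } n \text{ is odd},\\[2pt] -\frac{n(3n-2)}{8}x+\frac{n}{2}(a-1) & \text{if } n \text{ is even}.\end{cases} \]
   Context: $\langle n_1,\ldots,n_t\rangle$ denotes the set of nonnegative integer combinations of $n_1,\ldots,n_t$. For a numerical semigroup $S$ of genus $g$ (number of elements of $\mathbb{N}_0\setminus S$), the ordinarization number $r(S)$ is the number of iterations of $T\mapsto T\cup\{F(T)\}\setminus\{m(T)\}$ ($F$ = largest gap, $m$ = smallest nonzero element) needed to reach $\{0,g+1,g+2,\ldots\}$; it is known that $r(S)=\#(S\cap\{1,\ldots,g\})$. -}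

module Defs where

open import Data.Nat using (ℕ; zero; suc; _+_; _*_; _∸_; _≤_; _<_; NonZero)
open import Data.Nat.DivMod using (_/_)
open import Data.List using (List; []; _∷_; length; map; upTo; zipWith)
open import Data.Nat.ListAction using (sum)
open import Data.List.Membership.Propositional using (_∈_)
open import Data.List.Relation.Unary.Unique.Propositional using (Unique)
open import Data.Product using (Σ; _×_; ∃)
open import Relation.Binary.PropositionalEquality using (_≡_)
open import Relation.Nullary using (¬_)
open import Function.Bundles using (_⇔_)

NSet : Set₁
NSet = ℕ → Set

⟨_⟩ : List ℕ → NSet
⟨ gens ⟩ s = Σ (List ℕ) λ c → (length c ≡ length gens) × (sum (zipWith _*_ c gens) ≡ s)

interval : ℕ → ℕ → List ℕ
interval a x = map (a +_) (upTo (suc x))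

IsGenus : NSet → ℕ → Set
IsGenus S g = Σ (List ℕ) λ L → Unique L × (∀ y → (y ∈ L) ⇔ (¬ S y)) × (length L ≡ g)

-- r is #(S ∩ {1,…,g}), which is the ordinarization number r(S) of a
-- numerical semigroup of genus g.
IsOrdNumber : NSet → ℕ → ℕ → Set
IsOrdNumber S g r = Σ (List ℕ) λ L → Unique L × (∀ y → (y ∈ L) ⇔ ((1 ≤ y) × (y ≤ g) × S y)) × (length L ≡ r)

ceilDiv : (m x : ℕ) → .{{NonZero x}} → ℕ
ceilDiv m x = (m + (x ∸ 1)) / x

{-# OPTIONS --safe #-}
-- Every element of S = ⟨a, a+1, …, a+x⟩ is a sum of k generators, hence of the form k·a + j with
-- 0 ≤ j ≤ k·x, and conversely.  So as long as k·x < a the block [k·a, (k+1)·a) starts with k·x + 1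
-- elements of S and ends with gaps.  With n = ⌈(a−1)/x⌉ all gaps lie below n·a, and counting block by
-- block gives 2g = 2n(a−1) − n(n−1)x.  Writing a − 2 = e + (n−1)x with e < x and p = ⌊n/2⌋, one solves
-- g + 1 = p·a + j explicitly: for odd n it lies in the gap part of block p, for even n in its element
-- part.  Then r = #(S ∩ [0, g]) − 1 is read off from the same block count.
module Submission where

open import Data.Empty using (⊥-elim)
open import Data.Integer.Properties using (pos-+; pos-*)
import Data.Integer.Tactic.RingSolver as ℤ-Solver
open import Data.List using (List; []; _∷_; length; map; upTo; zipWith; filter; downFrom)
open import Data.List.Membership.Propositional using (_∈_)
open import Data.List.Membership.Propositional.Properties
  using (∈-map⁺; ∈-upTo⁺; ∈-upTo⁻; ∈-filter⁻; ∈-filter⁺; ∈-downFrom⁺)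
open import Data.List.Properties using (filter-accept; filter-reject; length-map)
open import Data.List.Relation.Unary.All as All using (All; []; _∷_)
open import Data.List.Relation.Unary.Any using (here; there)
open import Data.List.Relation.Unary.Unique.Propositional using (Unique)
open import Data.List.Relation.Unary.Unique.Propositional.Properties using (filter⁺; downFrom⁺)
import Data.Nat as ℕ
open import Data.Nat using (ℕ; zero; suc; _∸_; _⊓_; _≤_; _<_; _≤?_; z≤n; s≤s; s≤s⁻¹; NonZero)
open import Data.Nat.DivMod using (_/_; _%_; m≡m%n+[m/n]*n; m%n<n; m*n/n≡m; /-monoˡ-≤; /-congˡ; m/n≡1+[m∸n]/n)
open import Data.Nat.ListAction using (sum)
open import Data.Nat.Properties
open import Data.Nat.Tactic.RingSolver using (solve-∀)
open import Data.Product using (Σ; ∃₂; _×_; _,_; proj₁; proj₂)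
open import Function using (_∘_)
open import Function.Bundles using (_⇔_; mk⇔)
open import Relation.Binary.PropositionalEquality
open import Relation.Nullary using (¬_; Dec; yes; no; ¬?; contradiction)
open import Relation.Nullary.Decidable using (_×-dec_)
open import Relation.Unary using (Decidable)

open import Defs

module Counting where

  open import Data.Nat using (_+_)
  open ≡-Reasoning

  HasSize : (ℕ → Set) → ℕ → Set
  HasSize P k = Σ (List ℕ) λ L → Unique L × (∀ y → y ∈ L ⇔ P y) × length L ≡ k

  module _ {P : ℕ → Set} (P? : Decidable P) where

    countBelow : ℕ → ℕ
    countBelow N = length (filter P? (downFrom N))

    countBelow-suc⁺ : ∀ {N} → P N → countBelow (suc N) ≡ suc (countBelow N)
    countBelow-suc⁺ PN = cong length (filter-accept P? PN)

    countBelow-suc⁻ : ∀ {N} → ¬ P N → countBelow (suc N) ≡ countBelow N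
    countBelow-suc⁻ ¬PN = cong length (filter-reject P? ¬PN)

    hasSize-countBelow : ∀ N → (∀ {y} → P y → y < N) → HasSize P (countBelow N)
    hasSize-countBelow N bounded =
      filter P? (downFrom N) , filter⁺ P? (downFrom⁺ N) ,
      (λ y → mk⇔ (proj₂ ∘ ∈-filter⁻ P? {xs = downFrom N})
                 (λ Py → ∈-filter⁺ P? (∈-downFrom⁺ (bounded Py)) Py)) ,
      refl

  countBelow-complement : ∀ {P : ℕ → Set} (P? : Decidable P) N →
    countBelow P? N + countBelow (¬? ∘ P?) N ≡ N
  countBelow-complement P? zero = refl
  countBelow-complement P? (suc N) with P? N
  ... | yes _ = cong suc (countBelow-complement P? N)
  ... | no _  = trans (+-suc _ _) (cong suc (countBelow-complement P? N))

  _∩[1,_] : (ℕ → Set) → ℕ → ℕ → Set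
  (P ∩[1, g ]) y = 1 ≤ y × y ≤ g × P y

  _∩?[1,_] : ∀ {P : ℕ → Set} → Decidable P → ∀ g → Decidable (P ∩[1, g ])
  (P? ∩?[1, g ]) y = (1 ≤? y) ×-dec (y ≤? g) ×-dec P? y

  suc-countBelow-∩[1,] : ∀ {P : ℕ → Set} (P? : Decidable P) g → P 0 → ∀ N → N ≤ g →
    suc (countBelow (P? ∩?[1, g ]) (suc N)) ≡ countBelow P? (suc N)
  suc-countBelow-∩[1,] P? g P0 zero _ = begin
    suc (countBelow (P? ∩?[1, g ]) 1) ≡⟨ cong suc (countBelow-suc⁻ (P? ∩?[1, g ]) {0} λ { (() , _) }) ⟩
    1                                  ≡⟨ countBelow-suc⁺ P? P0 ⟨
    countBelow P? 1                    ∎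
  suc-countBelow-∩[1,] {P} P? g P0 (suc N) N<g = step (P? (suc N))
    where
    Q? = P? ∩?[1, g ]
    IH : suc (countBelow Q? (suc N)) ≡ countBelow P? (suc N)
    IH = suc-countBelow-∩[1,] P? g P0 N (<⇒≤ N<g)
    step : Dec (P (suc N)) → suc (countBelow Q? (2 + N)) ≡ countBelow P? (2 + N)
    step (yes PN) = begin
      suc (countBelow Q? (2 + N))       ≡⟨ cong suc (countBelow-suc⁺ Q? (s≤s z≤n , N<g , PN)) ⟩
      suc (suc (countBelow Q? (suc N))) ≡⟨ cong suc IH ⟩
      suc (countBelow P? (suc N))       ≡⟨ countBelow-suc⁺ P? PN ⟨
      countBelow P? (2 + N)             ∎
    step (no ¬PN) = begin
      suc (countBelow Q? (2 + N))       ≡⟨ cong suc (countBelow-suc⁻ Q? (¬PN ∘ proj₂ ∘ proj₂)) ⟩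
      suc (countBelow Q? (suc N))       ≡⟨ IH ⟩
      countBelow P? (suc N)             ≡⟨ countBelow-suc⁻ P? ¬PN ⟨
      countBelow P? (2 + N)             ∎

open Counting

module IntervalSemigroup where

  open import Data.Nat using (_+_; _*_)

  cancel-equals : ∀ {A B U V} → A + U ≡ B + V → U ≡ V → A ≡ B
  cancel-equals {A} {B} {U} eq refl = +-cancelʳ-≡ U A B eq

  ⟨⟩-zero : ∀ gens → ⟨ gens ⟩ 0
  ⟨⟩-zero []         = [] , refl , refl
  ⟨⟩-zero (_ ∷ gens) = let cs , len , sum≡ = ⟨⟩-zero gens in 0 ∷ cs , cong suc len , sum≡

  ⟨⟩-+-generator : ∀ {gens g s} → g ∈ gens → ⟨ gens ⟩ s → ⟨ gens ⟩ (g + s)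
  ⟨⟩-+-generator {_ ∷ _} _ ([] , () , _)
  ⟨⟩-+-generator {h ∷ _} (here refl) (c ∷ cs , len , refl) = suc c ∷ cs , len , +-assoc h (c * h) _
  ⟨⟩-+-generator {h ∷ _} {g} (there g∈) (c ∷ cs , len , refl) =
    let cs′ , len′ , sum≡ = ⟨⟩-+-generator g∈ (cs , suc-injective len , refl)
    in c ∷ cs′ , cong suc len′ , trans (cong (c * h +_) sum≡) (+-comm-middle (c * h) g _)
    where
    +-comm-middle : ∀ u v w → u + (v + w) ≡ v + (u + w)
    +-comm-middle = solve-∀

  module Interval (a x : ℕ) where

    S : ℕ → Set
    S = ⟨ interval a x ⟩

    generator∈ : ∀ {t} → t ≤ x → a + t ∈ interval a x
    generator∈ t≤x = ∈-map⁺ (a +_) (∈-upTo⁺ (s≤s t≤x))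

    S-block⁺ : ∀ k {j} → j ≤ k * x → S (k * a + j)
    S-block⁺ zero z≤n = ⟨⟩-zero (interval a x)
    S-block⁺ (suc k) {j} j≤ =
      subst S split (⟨⟩-+-generator (generator∈ excess≤x) (S-block⁺ k (m⊓n≤m (k * x) j)))
      where
      open ≡-Reasoning
      excess≤x : j ∸ k * x ≤ x
      excess≤x = m≤n+o⇒m∸n≤o j (k * x) (subst (j ≤_) (+-comm x (k * x)) j≤)
      rearrange : ∀ u v w z → u + v + (w + z) ≡ u + w + (z + v)
      rearrange = solve-∀
      split : a + (j ∸ k * x) + (k * a + (k * x) ⊓ j) ≡ suc k * a + j
      split = begin
        a + (j ∸ k * x) + (k * a + (k * x) ⊓ j) ≡⟨ rearrange a (j ∸ k * x) (k * a) ((k * x) ⊓ j) ⟩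
        a + k * a + ((k * x) ⊓ j + (j ∸ k * x)) ≡⟨ cong (a + k * a +_) (m⊓n+n∸m≡n (k * x) j) ⟩
        suc k * a + j                         ∎

    combination-block : ∀ cs ts → length cs ≡ length ts → All (_≤ x) ts →
      ∃₂ λ k j → j ≤ k * x × k * a + j ≡ sum (zipWith _*_ cs (map (a +_) ts))
    combination-block []       []       _   _              = 0 , 0 , z≤n , refl
    combination-block (c ∷ cs) (t ∷ ts) len (t≤x ∷ ts≤x) =
      let k , j , j≤kx , sum≡ = combination-block cs ts (suc-injective len) ts≤x
      in c + k , c * t + j ,
         ≤-trans (+-mono-≤ (*-monoʳ-≤ c t≤x) j≤kx) (≤-reflexive (sym (*-distribʳ-+ x c k))) ,
         trans (distribute a c k t j) (cong (c * (a + t) +_) sum≡)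
      where
      distribute : ∀ a c k t j → (c + k) * a + (c * t + j) ≡ c * (a + t) + (k * a + j)
      distribute = solve-∀

    S⇒block : ∀ {y} → S y → ∃₂ λ k j → j ≤ k * x × k * a + j ≡ y
    S⇒block (cs , len , refl) =
      combination-block cs (upTo (suc x)) (trans len (length-map (a +_) (upTo (suc x)))) (All.tabulate (s≤s⁻¹ ∘ ∈-upTo⁻))

    S-block⁻ : ∀ k {j} → j < a → S (k * a + j) → j ≤ k * x
    S-block⁻ k {j} j<a Sy with S⇒block Sy
    ... | k′ , j′ , j′≤k′x , eq = ≤-trans j≤j′ (≤-trans j′≤k′x (*-monoˡ-≤ x k′≤k))
      where
      open ≤-Reasoning
      k′≤k : k′ ≤ k
      k′≤k = s≤s⁻¹ (*-cancelʳ-< a k′ (suc k) (begin-strict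
        k′ * a      ≤⟨ m≤m+n (k′ * a) j′ ⟩
        k′ * a + j′ ≡⟨ eq ⟩
        k * a + j   <⟨ +-monoʳ-< (k * a) j<a ⟩
        k * a + a   ≡⟨ +-comm (k * a) a ⟩
        suc k * a   ∎))
      j≤j′ : j ≤ j′
      j≤j′ = +-cancelˡ-≤ (k′ * a) j j′ (begin
        k′ * a + j  ≤⟨ +-monoˡ-≤ j (*-monoˡ-≤ a k′≤k) ⟩
        k * a + j   ≡⟨ eq ⟨
        k′ * a + j′ ∎)

    module _ .{{_ : NonZero a}} where

      quotient-remainder : ∀ y → y / a * a + y % a ≡ y
      quotient-remainder y = trans (+-comm (y / a * a) (y % a)) (sym (m≡m%n+[m/n]*n y a))

      S? : Decidable S
      S? y with y % a ≤? y / a * x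
      ... | yes r≤qx = yes (subst S (quotient-remainder y) (S-block⁺ (y / a) r≤qx))
      ... | no  r≰qx = no (r≰qx ∘ S-block⁻ (y / a) (m%n<n y a) ∘ subst S (sym (quotient-remainder y)))

      gap< : ∀ n → a ≤ suc (n * x) → ∀ {y} → ¬ S y → y < n * a
      gap< n a≤ {y} ¬Sy with n * a ≤? y
      ... | no  y≱na = ≰⇒> y≱na
      ... | yes na≤y = ⊥-elim (¬Sy (subst S (quotient-remainder y) (S-block⁺ (y / a) r≤qx)))
        where
        n≤q : n ≤ y / a
        n≤q = subst (_≤ y / a) (m*n/n≡m n a) (/-monoˡ-≤ a na≤y)
        r≤qx : y % a ≤ y / a * x
        r≤qx = ≤-trans (s≤s⁻¹ (≤-trans (m%n<n y a) a≤)) (*-monoˡ-≤ x n≤q)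

      elementsBelow gapsBelow : ℕ → ℕ
      elementsBelow = countBelow S?
      gapsBelow     = countBelow (¬? ∘ S?)

      elementsBelow-block : ∀ k j → j ≤ a →
        elementsBelow (k * a + j) ≡ elementsBelow (k * a) + j ⊓ suc (k * x)
      elementsBelow-block k zero _ =
        trans (cong elementsBelow (+-identityʳ (k * a))) (sym (+-identityʳ _))
      elementsBelow-block k (suc j) j<a with j ≤? k * x
      ... | yes j≤kx = begin
        elementsBelow (k * a + suc j)                      ≡⟨ cong elementsBelow (+-suc (k * a) j) ⟩
        elementsBelow (suc (k * a + j))                    ≡⟨ countBelow-suc⁺ S? (S-block⁺ k j≤kx) ⟩
        suc (elementsBelow (k * a + j))                    ≡⟨ cong suc (elementsBelow-block k j (<⇒≤ j<a)) ⟩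
        suc (elementsBelow (k * a) + j ⊓ suc (k * x))      ≡⟨ +-suc _ _ ⟨
        elementsBelow (k * a) + suc (j ⊓ suc (k * x))      ≡⟨ cong (λ i → elementsBelow (k * a) + suc i) j⊓≡ ⟩
        elementsBelow (k * a) + suc j ⊓ suc (k * x)        ∎
        where
        open ≡-Reasoning
        j⊓≡ : j ⊓ suc (k * x) ≡ j ⊓ (k * x)
        j⊓≡ = trans (m≤n⇒m⊓n≡m (m≤n⇒m≤1+n j≤kx)) (sym (m≤n⇒m⊓n≡m j≤kx))
      ... | no j≰kx = begin
        elementsBelow (k * a + suc j)                      ≡⟨ cong elementsBelow (+-suc (k * a) j) ⟩
        elementsBelow (suc (k * a + j))                    ≡⟨ countBelow-suc⁻ S? (j≰kx ∘ S-block⁻ k j<a) ⟩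
        elementsBelow (k * a + j)                          ≡⟨ elementsBelow-block k j (<⇒≤ j<a) ⟩
        elementsBelow (k * a) + j ⊓ suc (k * x)            ≡⟨ cong (elementsBelow (k * a) +_) j⊓≡ ⟩
        elementsBelow (k * a) + suc j ⊓ suc (k * x)        ∎
        where
        open ≡-Reasoning
        kx<j = ≰⇒> j≰kx
        j⊓≡ : j ⊓ suc (k * x) ≡ suc (j ⊓ (k * x))
        j⊓≡ = trans (m≥n⇒m⊓n≡n kx<j) (sym (cong suc (m≥n⇒m⊓n≡n (<⇒≤ kx<j))))

      -- That is, 2·elementsBelow (k·a) = k(2 + (k − 1)x): block i < k contributes i·x + 1 elements.
      elementsBelow-blocks : ∀ k → (k ∸ 1) * x < a → 2 * elementsBelow (k * a) + k * x ≡ k * (2 + k * x)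
      elementsBelow-blocks zero    _    = refl
      elementsBelow-blocks (suc k) kx<a = begin
        2 * elementsBelow (suc k * a) + suc k * x
          ≡⟨ cong (λ e → 2 * e + suc k * x) next-block ⟩
        2 * (elementsBelow (k * a) + suc (k * x)) + suc k * x
          ≡⟨ cancel-equals (step (elementsBelow (k * a)) k x) (sym IH) ⟩
        suc k * (2 + suc k * x) ∎
        where
        open ≡-Reasoning
        next-block : elementsBelow (suc k * a) ≡ elementsBelow (k * a) + suc (k * x)
        next-block = begin
          elementsBelow (a + k * a)               ≡⟨ cong elementsBelow (+-comm a (k * a)) ⟩
          elementsBelow (k * a + a)               ≡⟨ elementsBelow-block k a ≤-refl ⟩
          elementsBelow (k * a) + a ⊓ suc (k * x) ≡⟨ cong (elementsBelow (k * a) +_) (m≥n⇒m⊓n≡n kx<a) ⟩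
          elementsBelow (k * a) + suc (k * x)     ∎
        IH : 2 * elementsBelow (k * a) + k * x ≡ k * (2 + k * x)
        IH = elementsBelow-blocks k (≤-<-trans (*-monoˡ-≤ x (m∸n≤m k 1)) kx<a)
        step : ∀ E k x → 2 * (E + suc (k * x)) + suc k * x + k * (2 + k * x)
                       ≡ suc k * (2 + suc k * x) + (2 * E + k * x)
        step = solve-∀

      genus-identity : ∀ n → (n ∸ 1) * x < a → 2 * gapsBelow (n * a) + n * (2 + n * x) ≡ 2 * (n * a) + n * x
      genus-identity n blocks<a = begin
        2 * gapsBelow (n * a) + n * (2 + n * x)
          ≡⟨ cong (2 * gapsBelow (n * a) +_) (elementsBelow-blocks n blocks<a) ⟨
        2 * gapsBelow (n * a) + (2 * elementsBelow (n * a) + n * x)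
          ≡⟨ regroup (gapsBelow (n * a)) (elementsBelow (n * a)) (n * x) ⟩
        2 * (elementsBelow (n * a) + gapsBelow (n * a)) + n * x
          ≡⟨ cong (λ N → 2 * N + n * x) (countBelow-complement S? (n * a)) ⟩
        2 * (n * a) + n * x ∎
        where
        open ≡-Reasoning
        regroup : ∀ G E y → 2 * G + (2 * E + y) ≡ 2 * (E + G) + y
        regroup = solve-∀

      suc-gapsBelow≡ : ∀ n p j → (n ∸ 1) * x < a →
        2 + (2 * (n * a) + n * x) ≡ 2 * (p * a + j) + n * (2 + n * x) → suc (gapsBelow (n * a)) ≡ p * a + j
      suc-gapsBelow≡ n p j blocks<a eq = *-cancelˡ-≡ (suc g) (p * a + j) 2
        (+-cancelʳ-≡ (n * (2 + n * x)) (2 * suc g) (2 * (p * a + j)) (begin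
          2 * suc g + n * (2 + n * x)       ≡⟨ cong (_+ n * (2 + n * x)) (*-suc 2 g) ⟩
          2 + (2 * g + n * (2 + n * x))     ≡⟨ cong (2 +_) (genus-identity n blocks<a) ⟩
          2 + (2 * (n * a) + n * x)         ≡⟨ eq ⟩
          2 * (p * a + j) + n * (2 + n * x) ∎))
        where
        open ≡-Reasoning
        g = gapsBelow (n * a)

      isGenus : ∀ n → a ≤ suc (n * x) → IsGenus S (gapsBelow (n * a))
      isGenus n a≤ = hasSize-countBelow (¬? ∘ S?) (n * a) (gap< n a≤)

      ordNumber : ℕ → ℕ
      ordNumber g = countBelow (S? ∩?[1, g ]) (suc g)

      isOrdNumber : ∀ g → IsOrdNumber S g (ordNumber g)
      isOrdNumber g = hasSize-countBelow (S? ∩?[1, g ]) (suc g) (s≤s ∘ proj₁ ∘ proj₂)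

      ordNumber-identity : ∀ g p j → suc g ≡ p * a + j → j ≤ a → p * x < a →
        2 * suc (ordNumber g) + p * x ≡ p * (2 + p * x) + 2 * (j ⊓ suc (p * x))
      ordNumber-identity g p j suc-g≡ j≤a px<a = begin
        2 * suc (ordNumber g) + p * x
          ≡⟨ cong (λ e → 2 * e + p * x) (suc-countBelow-∩[1,] S? g (S-block⁺ 0 z≤n) g ≤-refl) ⟩
        2 * elementsBelow (suc g) + p * x
          ≡⟨ cong (λ e → 2 * elementsBelow e + p * x) suc-g≡ ⟩
        2 * elementsBelow (p * a + j) + p * x
          ≡⟨ cong (λ e → 2 * e + p * x) (elementsBelow-block p j j≤a) ⟩
        2 * (elementsBelow (p * a) + j ⊓ suc (p * x)) + p * x
          ≡⟨ regroup (elementsBelow (p * a)) (j ⊓ suc (p * x)) (p * x) ⟩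
        2 * elementsBelow (p * a) + p * x + 2 * (j ⊓ suc (p * x))
          ≡⟨ cong (_+ 2 * (j ⊓ suc (p * x))) (elementsBelow-blocks p (≤-<-trans (*-monoˡ-≤ x (m∸n≤m p 1)) px<a)) ⟩
        p * (2 + p * x) + 2 * (j ⊓ suc (p * x)) ∎
        where
        open ≡-Reasoning
        regroup : ∀ E J y → 2 * (E + J) + y ≡ 2 * E + y + 2 * J
        regroup = solve-∀

  ceilDiv-suc : ∀ m x .{{_ : NonZero x}} → ceilDiv (suc m) x ≡ suc (m / x)
  ceilDiv-suc m (suc w) = begin
    (suc m + w) / suc w                ≡⟨ /-congˡ (sym (+-suc m w)) ⟩
    (m + suc w) / suc w                ≡⟨ m/n≡1+[m∸n]/n (m≤n+m (suc w) m) ⟩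
    suc ((m + suc w ∸ suc w) / suc w)  ≡⟨ cong (λ i → suc (i / suc w)) (m+n∸n≡m m (suc w)) ⟩
    suc (m / suc w)                    ∎
    where open ≡-Reasoning

  m<ceilDiv[1+m]*x : ∀ m x .{{_ : NonZero x}} → m < ceilDiv (suc m) x * x
  m<ceilDiv[1+m]*x m x = begin-strict
    m                          ≡⟨ m≡m%n+[m/n]*n m x ⟩
    m % x + m / x * x          <⟨ +-monoˡ-< (m / x * x) (m%n<n m x) ⟩
    x + m / x * x              ≡⟨ cong (_* x) (ceilDiv-suc m x) ⟨
    ceilDiv (suc m) x * x      ∎
    where open ≤-Reasoning

  ordNumber-odd : ∀ {m x n e p} → e < x → m ≡ e + p * 2 * x → n ≡ suc (p * 2) →
    let open Interval (2 + m) x in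
    8 * ordNumber (gapsBelow (n * (2 + m))) + x + 4 ≡ n * n * x + 4 * n
  ordNumber-odd {x = x} {e = e} {p} e<x refl refl = cancel-equals (final r p x) (cong (4 *_) (sym r-identity))
    where
    a = 2 + (e + p * 2 * x)
    n = suc (p * 2)
    open Interval a x
    g = gapsBelow (n * a)
    r = ordNumber g
    j = suc (p * x) + suc (suc p * e)
    2px<a : p * 2 * x < a
    2px<a = s≤s (m≤n⇒m≤1+n (m≤n+m (p * 2 * x) e))
    px<a : p * x < a
    px<a = ≤-<-trans (*-monoˡ-≤ x (m≤m*n p 2)) 2px<a
    location : ∀ p e x → 2 + (2 * (suc (p * 2) * (2 + (e + p * 2 * x))) + suc (p * 2) * x)
                       ≡ 2 * (p * (2 + (e + p * 2 * x)) + (suc (p * x) + suc (suc p * e)))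
                         + suc (p * 2) * (2 + suc (p * 2) * x)
    location = solve-∀
    suc-g≡ : suc g ≡ p * a + j
    suc-g≡ = suc-gapsBelow≡ n p j 2px<a (location p e x)
    j≤a : j ≤ a
    j≤a = begin
      suc (p * x) + suc (suc p * e)  ≤⟨ +-monoʳ-≤ (suc (p * x)) (s≤s (+-monoʳ-≤ e (*-monoʳ-≤ p (<⇒≤ e<x)))) ⟩
      suc (p * x) + suc (e + p * x)  ≡⟨ spread p e x ⟩
      a                              ∎
      where
      open ≤-Reasoning
      spread : ∀ p e x → suc (p * x) + suc (e + p * x) ≡ 2 + (e + p * 2 * x)
      spread = solve-∀
    r-identity : 2 * suc r + p * x ≡ p * (2 + p * x) + 2 * suc (p * x)
    r-identity = trans (ordNumber-identity g p j suc-g≡ j≤a px<a)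
                       (cong (λ i → p * (2 + p * x) + 2 * i) (m≥n⇒m⊓n≡n (m≤m+n (suc (p * x)) _)))
    final : ∀ r p x → 8 * r + x + 4 + 4 * (p * (2 + p * x) + 2 * suc (p * x))
                    ≡ suc (p * 2) * suc (p * 2) * x + 4 * suc (p * 2) + 4 * (2 * suc r + p * x)
    final = solve-∀

  ordNumber-even : ∀ {m x n e q} → e < x → m ≡ e + suc (q * 2) * x → n ≡ suc q * 2 →
    let open Interval (2 + m) x in
    8 * ordNumber (gapsBelow (n * (2 + m))) + 3 * n * n * x + 4 * n ≡ 4 * n * (2 + m) + 2 * n * x
  ordNumber-even {x = x} {e = e} {q} e<x refl refl = cancel-equals (final r q e x) (cong (4 *_) (sym r-identity))
    where
    a = 2 + (e + suc (q * 2) * x)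
    n = suc q * 2
    p = suc q
    open Interval a x
    g = gapsBelow (n * a)
    r = ordNumber g
    j = suc (p * e)
    px≤ : p * x ≤ e + suc (q * 2) * x
    px≤ = ≤-trans (*-monoˡ-≤ x (s≤s (m≤m*n q 2))) (m≤n+m _ e)
    blocks<a : suc (q * 2) * x < a
    blocks<a = s≤s (m≤n⇒m≤1+n (m≤n+m (suc (q * 2) * x) e))
    px<a : p * x < a
    px<a = s≤s (m≤n⇒m≤1+n px≤)
    location : ∀ q e x → 2 + (2 * (suc q * 2 * (2 + (e + suc (q * 2) * x))) + suc q * 2 * x)
                       ≡ 2 * (suc q * (2 + (e + suc (q * 2) * x)) + suc (suc q * e))
                         + suc q * 2 * (2 + suc q * 2 * x)
    location = solve-∀
    suc-g≡ : suc g ≡ p * a + j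
    suc-g≡ = suc-gapsBelow≡ n p j blocks<a (location q e x)
    j≤px : j ≤ suc (p * x)
    j≤px = s≤s (*-monoʳ-≤ p (<⇒≤ e<x))
    j≤a : j ≤ a
    j≤a = ≤-trans j≤px (s≤s (m≤n⇒m≤1+n px≤))
    r-identity : 2 * suc r + p * x ≡ p * (2 + p * x) + 2 * j
    r-identity = trans (ordNumber-identity g p j suc-g≡ j≤a px<a)
                       (cong (λ i → p * (2 + p * x) + 2 * i) (m≤n⇒m⊓n≡m j≤px))
    final : ∀ r q e x →
      8 * r + 3 * (suc q * 2) * (suc q * 2) * x + 4 * (suc q * 2) + 4 * (suc q * (2 + suc q * x) + 2 * suc (suc q * e))
      ≡ 4 * (suc q * 2) * (2 + (e + suc (q * 2) * x)) + 2 * (suc q * 2) * x + 4 * (2 * suc r + suc q * x)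
    final = solve-∀

  ordinarization-ℕ : ∀ m x .{{_ : NonZero x}} →
    let a = 2 + m
        n = ceilDiv (suc m) x
    in Σ ℕ λ g → IsGenus ⟨ interval a x ⟩ g × Σ ℕ λ r → IsOrdNumber ⟨ interval a x ⟩ g r ×
       ((n % 2 ≡ 1 → 8 * r + x + 4 ≡ n * n * x + 4 * n)
       × (n % 2 ≡ 0 → 8 * r + 3 * n * n * x + 4 * n ≡ 4 * n * a + 2 * n * x))
  ordinarization-ℕ m x = g , isGenus n (s≤s (m<ceilDiv[1+m]*x m x)) , ordNumber g , isOrdNumber g , odd , even
    where
    a = 2 + m
    n = ceilDiv (suc m) x
    open Interval a x
    g = gapsBelow (n * a)
    m≡ : ∀ {k} → m / x ≡ k → m ≡ m % x + k * x
    m≡ refl = m≡m%n+[m/n]*n m x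
    n≡ : ∀ {b} → n % 2 ≡ b → n ≡ b + n / 2 * 2
    n≡ refl = m≡m%n+[m/n]*n n 2
    odd : n % 2 ≡ 1 → 8 * ordNumber g + x + 4 ≡ n * n * x + 4 * n
    odd n%2≡1 = ordNumber-odd {p = n / 2} (m%n<n m x)
                  (m≡ (suc-injective (trans (sym (ceilDiv-suc m x)) (n≡ n%2≡1)))) (n≡ n%2≡1)
    even : n % 2 ≡ 0 → 8 * ordNumber g + 3 * n * n * x + 4 * n ≡ 4 * n * a + 2 * n * x
    even n%2≡0 with n / 2 | n≡ n%2≡0
    ... | zero  | n≡0    = contradiction (trans (sym n≡0) (ceilDiv-suc m x)) 0≢1+n
    ... | suc q | n≡2q+2 = ordNumber-even {q = q} (m%n<n m x)
                              (m≡ (suc-injective (trans (sym (ceilDiv-suc m x)) n≡2q+2))) n≡2q+2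

open IntervalSemigroup using (ordinarization-ℕ)
open import Data.Integer using (+_; -_; _+_; _-_; _*_)
open ≡-Reasoning

pos-*³ : ∀ a b c → + (a ℕ.* b ℕ.* c) ≡ + a * + b * + c
pos-*³ a b c = trans (pos-* (a ℕ.* b) c) (cong (_* + c) (pos-* a b))

odd-formula : ∀ r n x → 8 ℕ.* r ℕ.+ x ℕ.+ 4 ≡ n ℕ.* n ℕ.* x ℕ.+ 4 ℕ.* n →
  + 8 * + r ≡ (+ n * + n - + 1) * + x + + 4 * (+ n - + 1)
odd-formula r n x eq = begin
  + 8 * + r                                   ≡⟨ add-subtract (+ r) (+ x) ⟩
  (+ 8 * + r + + x + + 4) - (+ x + + 4)       ≡⟨ cong (_- (+ x + + 4)) eqℤ ⟩
  (+ n * + n * + x + + 4 * + n) - (+ x + + 4) ≡⟨ regroup (+ n) (+ x) ⟩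
  (+ n * + n - + 1) * + x + + 4 * (+ n - + 1) ∎
  where
  add-subtract : ∀ r x → + 8 * r ≡ (+ 8 * r + x + + 4) - (x + + 4)
  add-subtract = ℤ-Solver.solve-∀
  regroup : ∀ n x → (n * n * x + + 4 * n) - (x + + 4) ≡ (n * n - + 1) * x + + 4 * (n - + 1)
  regroup = ℤ-Solver.solve-∀
  eqℤ : + 8 * + r + + x + + 4 ≡ + n * + n * + x + + 4 * + n
  eqℤ = begin
    + 8 * + r + + x + + 4            ≡⟨ cong (λ i → i + + x + + 4) (pos-* 8 r) ⟨
    + (8 ℕ.* r) + + x + + 4          ≡⟨ cong (_+ + 4) (pos-+ (8 ℕ.* r) x) ⟨
    + (8 ℕ.* r ℕ.+ x) + + 4          ≡⟨ pos-+ (8 ℕ.* r ℕ.+ x) 4 ⟨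
    + (8 ℕ.* r ℕ.+ x ℕ.+ 4)          ≡⟨ cong +_ eq ⟩
    + (n ℕ.* n ℕ.* x ℕ.+ 4 ℕ.* n)    ≡⟨ pos-+ (n ℕ.* n ℕ.* x) (4 ℕ.* n) ⟩
    + (n ℕ.* n ℕ.* x) + + (4 ℕ.* n)  ≡⟨ cong₂ _+_ (pos-*³ n n x) (pos-* 4 n) ⟩
    + n * + n * + x + + 4 * + n      ∎

even-formula : ∀ r n x a → 8 ℕ.* r ℕ.+ 3 ℕ.* n ℕ.* n ℕ.* x ℕ.+ 4 ℕ.* n ≡ 4 ℕ.* n ℕ.* a ℕ.+ 2 ℕ.* n ℕ.* x →
  + 8 * + r ≡ - (+ n * (+ 3 * + n - + 2)) * + x + + 4 * + n * (+ a - + 1)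
even-formula r n x a eq = begin
  + 8 * + r                                                   ≡⟨ add-subtract (+ r) (+ n) (+ x) ⟩
  (+ 8 * + r + + 3 * + n * + n * + x + + 4 * + n) - (+ 3 * + n * + n * + x + + 4 * + n)
                                                              ≡⟨ cong (_- (+ 3 * + n * + n * + x + + 4 * + n)) eqℤ ⟩
  (+ 4 * + n * + a + + 2 * + n * + x) - (+ 3 * + n * + n * + x + + 4 * + n)
                                                              ≡⟨ regroup (+ n) (+ x) (+ a) ⟩
  - (+ n * (+ 3 * + n - + 2)) * + x + + 4 * + n * (+ a - + 1) ∎
  where
  add-subtract : ∀ r n x → + 8 * r ≡ (+ 8 * r + + 3 * n * n * x + + 4 * n) - (+ 3 * n * n * x + + 4 * n)
  add-subtract = ℤ-Solver.solve-∀
  regroup : ∀ n x a → (+ 4 * n * a + + 2 * n * x) - (+ 3 * n * n * x + + 4 * n)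
                    ≡ - (n * (+ 3 * n - + 2)) * x + + 4 * n * (a - + 1)
  regroup = ℤ-Solver.solve-∀
  3nnx : + (3 ℕ.* n ℕ.* n ℕ.* x) ≡ + 3 * + n * + n * + x
  3nnx = trans (pos-* (3 ℕ.* n ℕ.* n) x) (cong (_* + x) (pos-*³ 3 n n))
  eqℤ : + 8 * + r + + 3 * + n * + n * + x + + 4 * + n ≡ + 4 * + n * + a + + 2 * + n * + x
  eqℤ = begin
    + 8 * + r + + 3 * + n * + n * + x + + 4 * + n
      ≡⟨ cong₂ (λ i j → i + j + + 4 * + n) (pos-* 8 r) 3nnx ⟨
    + (8 ℕ.* r) + + (3 ℕ.* n ℕ.* n ℕ.* x) + + 4 * + n
      ≡⟨ cong₂ _+_ (pos-+ (8 ℕ.* r) _) (pos-* 4 n) ⟨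
    + (8 ℕ.* r ℕ.+ 3 ℕ.* n ℕ.* n ℕ.* x) + + (4 ℕ.* n)
      ≡⟨ pos-+ (8 ℕ.* r ℕ.+ 3 ℕ.* n ℕ.* n ℕ.* x) (4 ℕ.* n) ⟨
    + (8 ℕ.* r ℕ.+ 3 ℕ.* n ℕ.* n ℕ.* x ℕ.+ 4 ℕ.* n)
      ≡⟨ cong +_ eq ⟩
    + (4 ℕ.* n ℕ.* a ℕ.+ 2 ℕ.* n ℕ.* x)
      ≡⟨ pos-+ (4 ℕ.* n ℕ.* a) (2 ℕ.* n ℕ.* x) ⟩
    + (4 ℕ.* n ℕ.* a) + + (2 ℕ.* n ℕ.* x)
      ≡⟨ cong₂ _+_ (pos-*³ 4 n a) (pos-*³ 2 n x) ⟩
    + 4 * + n * + a + + 2 * + n * + x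
      ∎

mainTheorem5 : (a x : ℕ) → .{{_ : NonZero a}} → .{{_ : NonZero x}} → x < a ∸ 1 →
  Σ ℕ λ g → IsGenus ⟨ interval a x ⟩ g × Σ ℕ λ r → IsOrdNumber ⟨ interval a x ⟩ g r ×
    ((ceilDiv (a ∸ 1) x % 2 ≡ 1 →
        + 8 * + r ≡ (+ ceilDiv (a ∸ 1) x * + ceilDiv (a ∸ 1) x - + 1) * + x + + 4 * (+ ceilDiv (a ∸ 1) x - + 1))
    × (ceilDiv (a ∸ 1) x % 2 ≡ 0 →
        + 8 * + r ≡ - (+ ceilDiv (a ∸ 1) x * (+ 3 * + ceilDiv (a ∸ 1) x - + 2)) * + x + + 4 * + ceilDiv (a ∸ 1) x * (+ a - + 1)))
mainTheorem5 zero          _ ()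
mainTheorem5 (suc zero)    _ ()
mainTheorem5 (suc (suc m)) x _ =
  let g , isGenus , r , isOrdNumber , odd , even = ordinarization-ℕ m x
      n = ceilDiv (suc m) x
  in g , isGenus , r , isOrdNumber , odd-formula r n x ∘ odd , even-formula r n x (suc (suc m)) ∘ even
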